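{- Let $H$ be a finite digraph possibly with loops, $D$ a finite $H$-colored digraph without loops and without isolated vertices, and $\xi=\{C_1,\dots,C_k\}$ ($k\ge2$) a partition of $V(H)$ such that for every $i$ the set $A_i=\{a\in A(D):c(a)\in C_i\}$ is nonempty and $G_i=D[A_i]$ is transitive by $H$-paths. Let $\{\xi_1,\xi_2\}$ be a partition of $\xi$ and, for $i\in\{1,2\}$, let $D_i$ be the spanning subdigraph of $D$ with $A(D_i)=\{a\in A(D):c(a)\in C_j\text{ for some }C_j\in\xi_i\}$. Suppose that (1) for every $i\in\{1,2\}$ and every cycle $\gamma$ contained in $D_i$ there exists $C_m\in\xi_i$ such that $\gamma$ is contained in $G_m$, and (2) for every $i\in\{1,2\}$ and every $H$-walk $P$ contained in $D_i$ there exists $C_{m'}\in\xi_i$ such that $P$ is contained in $G_{m'}$. Then the family $\mathcal{S}$ of nonempty $H$-semikernels modulo $D_2$ of $D$ is nonempty, and the digraph $D_{\mathcal{S}}$ is acyclic.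
   Context: Paths, walks and cycles are directed; a path has pairwise distinct vertices. $D$ is $H$-colored if it has an arc coloring $c:A(D)\to V(H)$. A walk $(v_0,\dots,v_n)$ is an $H$-walk if $(c(v_0,v_1),\dots,c(v_{n-1},v_n))$ is a walk in $H$ (a single arc is an $H$-walk); an $H$-path is a path that is an $H$-walk. $D[A]$ for an arc set $A$ is the subdigraph with arc set $A$ and vertex set the ends of arcs in $A$. A subdigraph $G$ is transitive by $H$-paths if an $xy$-$H$-path contained in $G$ and a $yz$-$H$-path contained in $G$ imply an $xz$-$H$-path contained in $G$. A set $S\subseteq V(D)$ is an $H$-semikernel modulo $D_2$ of $D$ if (i) there is no $H$-path in $D$ between two distinct vertices of $S$, and (ii) for every $z\in V(D)\setminus S$, if there is an $H$-path contained in $D_1$ from a vertex of $S$ to $z$, then there is an $H$-path in $D$ from $z$ to a vertex of $S$. When $\mathcal{S}\neq\emptyset$, $D_{\mathcal{S}}$ is the digraph with vertex set $\mathcal{S}$ in which, for distinct $S_1,S_2\in\mathcal{S}$, $(S_1,S_2)$ is an arc iff for every $s_1\in S_1$ there exists $s_2\in S_2$ such that either $s_1=s_2$, or there is an $s_1s_2$-$H$-path contained in $D_2$ and there is no $s_2s_1$-$H$-path in $D$. -}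

module Defs where

open import Data.Nat using (ℕ; _≤_)
open import Data.Fin using (Fin; zero; suc)
open import Data.Fin.Subset using (Subset; _∈_; _∉_; Nonempty)
open import Data.Bool using (Bool; T)
open import Data.List using (List; []; _∷_; _++_; [_]; map)
open import Data.List.Relation.Unary.All using (All)
open import Data.List.Relation.Unary.Unique.Propositional using (Unique)
open import Data.Product using (Σ; ∃; _×_; _,_; proj₁; proj₂)
open import Data.Sum using (_⊎_)
open import Relation.Nullary using (¬_)
open import Relation.Binary.PropositionalEquality using (_≡_; _≢_)

Digraph : ℕ → Set
Digraph m = Fin m → Fin m → Bool

Arc : ∀ {m} → Digraph m → Fin m → Fin m → Set
Arc G u v = T (G u v)

consecutive : ∀ {A : Set} → List A → List (A × A)
consecutive [] = []
consecutive (x ∷ []) = []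
consecutive (x ∷ y ∷ xs) = (x , y) ∷ consecutive (y ∷ xs)

AllSteps : ∀ {A : Set} → (A → A → Set) → List A → Set
AllSteps R xs = All (λ p → R (proj₁ p) (proj₂ p)) (consecutive xs)

-- An arc coloring c : A(D) → V(H) is given as a function on all ordered
-- pairs; only its values on arcs of D are ever used.
Coloring : ℕ → ℕ → Set
Coloring n h = Fin n → Fin n → Fin h

colours : ∀ {n h} → Coloring n h → List (Fin n) → List (Fin h)
colours c vs = map (λ p → c (proj₁ p) (proj₂ p)) (consecutive vs)

IsHWalkSeq : ∀ {n h} → Digraph h → Coloring n h → List (Fin n) → Set
IsHWalkSeq H c vs = AllSteps (Arc H) (colours c vs)

walkSeq : ∀ {n} → Fin n → List (Fin n) → Fin n → List (Fin n)
walkSeq x ms y = x ∷ (ms ++ [ y ])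

-- A subdigraph is described by its arc predicate P (P u v implies an arc of D).
-- xy-H-walk contained in the subdigraph with arc predicate P
HWalkIn : ∀ {n h} → Digraph h → Coloring n h → (Fin n → Fin n → Set)
        → Fin n → List (Fin n) → Fin n → Set
HWalkIn H c P x ms y = AllSteps P (walkSeq x ms y) × IsHWalkSeq H c (walkSeq x ms y)

HPathIn : ∀ {n h} → Digraph h → Coloring n h → (Fin n → Fin n → Set)
        → Fin n → Fin n → Set
HPathIn {n} H c P x y =
  Σ (List (Fin n)) λ ms → Unique (walkSeq x ms y) × HWalkIn H c P x ms y

-- a subdigraph (arc predicate P) is transitive by H-paths
-- (for x ≠ z; an xz-path needs distinct ends)
TransitiveByHPaths : ∀ {n h} → Digraph h → Coloring n h → (Fin n → Fin n → Set) → Set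
TransitiveByHPaths H c P =
  ∀ x y z → x ≢ z → HPathIn H c P x y → HPathIn H c P y z → HPathIn H c P x z

CycleIn : ∀ {n} → (Fin n → Fin n → Set) → Fin n → List (Fin n) → Set
CycleIn P x ms = Unique (x ∷ ms) × AllSteps P (walkSeq x ms x)

-- S is an H-semikernel modulo D₂ of D, where D₁ (arc predicate P₁) is the
-- complementary spanning subdigraph used in condition (ii)
IsHSemikernelMod : ∀ {n h} → Digraph h → Digraph n → Coloring n h
                 → (Fin n → Fin n → Set) → Subset n → Set
IsHSemikernelMod H D c P₁ S =
  (∀ x y → x ∈ S → y ∈ S → x ≢ y → ¬ HPathIn H c (Arc D) x y)
  × (∀ z → z ∉ S → (∃ λ s → s ∈ S × HPathIn H c P₁ s z)
       → ∃ λ s → s ∈ S × HPathIn H c (Arc D) z s)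

-- arcs of D_𝒮 (P₂ is the arc predicate of D₂)
DSArc : ∀ {n h} → Digraph h → Digraph n → Coloring n h
      → (Fin n → Fin n → Set) → Subset n → Subset n → Set
DSArc H D c P₂ S₁ S₂ =
  S₁ ≢ S₂ × (∀ s₁ → s₁ ∈ S₁ → ∃ λ s₂ → s₂ ∈ S₂ ×
     (s₁ ≡ s₂ ⊎ (HPathIn H c P₂ s₁ s₂ × ¬ HPathIn H c (Arc D) s₂ s₁)))

HasCycle : ∀ {A : Set} → (A → Set) → (A → A → Set) → Set
HasCycle {A} V R =
  Σ A λ x → Σ (List A) λ xs → All V (x ∷ xs) × Unique (x ∷ xs) × AllSteps R (x ∷ (xs ++ [ x ]))

-- The cycle and walk hypotheses make H-paths of Dᵢ reversible inside D: an
-- H-path from x to y in Dᵢ lies in a single class Gₘ by (2); if y reaches x in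
-- Dᵢ, every arc of the path closes a cycle of Dᵢ, which lies in Gₘ by (1), so
-- transitivity of Gₘ yields an H-path from y back to x.
-- Hence any vertex of a terminal strong component of D₁ forms an H-semikernel
-- modulo D₂ on its own. An arc of D_𝒮 either keeps a vertex or moves it
-- strictly forward in the reachability preorder of D₂ (a way back would be
-- reversible). Around a cycle of D_𝒮 a vertex moved forward must come back to
-- its independent starting set, which well-founded induction along that
-- preorder excludes; so each set of the cycle is contained in the next, and
-- all of them coincide.

module Submission where

open import Defs
open import Data.Nat as ℕ using (ℕ; _≤_; s≤s)
open import Data.Nat.Properties using (<⇒≤)
open import Data.Fin using (Fin; zero; suc; _≟_)
open import Data.Fin.Properties using (any?; injective⇒≤)
open import Data.Fin.Subset using (Subset; Nonempty; _∈_; _∉_; _⊆_; _⊂_; ⁅_⁆)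
open import Data.Fin.Subset.Properties using (x∈⁅x⁆; x∈⁅y⁆⇒x≡y; ⊆-antisym)
open import Data.Fin.Subset.Induction using (⊂-wellFounded)
open import Data.Vec using (tabulate)
open import Data.Vec.Properties using (lookup∘tabulate; []=⇒lookup; lookup⇒[]=)
open import Data.Bool using (T?)
open import Data.List using (List; []; _∷_; _++_; [_]; length; lookup)
open import Data.List.Relation.Unary.All as All using (All; []; _∷_)
open import Data.List.Relation.Unary.All.Properties using (¬Any⇒All¬; ++⁻ˡ; ++⁻ʳ)
open import Data.List.Relation.Unary.Any using (here; there)
open import Data.List.Relation.Unary.AllPairs using ([]; _∷_)
open import Data.List.Relation.Unary.Unique.Propositional using (Unique)
import Data.List.Membership.DecPropositional as ListMembership
open import Data.List.Membership.Propositional.Properties using (∈-lookup)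
open import Data.Product using (Σ; ∃; _×_; _,_; proj₁; proj₂)
open import Data.Sum using (_⊎_; inj₁; inj₂)
open import Data.Empty using (⊥-elim)
open import Function using (_∘_)
open import Relation.Nullary using (¬_; Dec; yes; no; does)
open import Relation.Nullary.Decidable using (_×-dec_; _⊎-dec_; ¬?; dec-true; decidable-stable)
open import Relation.Binary.PropositionalEquality using (_≡_; _≢_; refl; sym; trans; cong)
open import Relation.Binary.Construct.Closure.ReflexiveTransitive as Star using (Star; ε; _◅_; _◅◅_)
open import Induction.WellFounded using (WellFounded; WfRec; module Subrelation)
import Relation.Binary.Construct.On as On
import Induction.WellFounded as WF

module _ {A : Set} where

  unique-rotate : ∀ {u : A} xs → Unique (xs ++ [ u ]) → Unique (u ∷ xs)
  unique-rotate [] p = p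
  unique-rotate {u} (x ∷ xs) (x∉ ∷ p) with unique-rotate xs p
  ... | u∉ ∷ q = (u≢x ∷ u∉) ∷ (++⁻ˡ xs x∉ ∷ q)
    where
    u≢x : u ≢ x
    u≢x = All.head (++⁻ʳ xs x∉) ∘ sym

  unique⇒lookup-injective : ∀ {xs : List A} → Unique xs →
                            ∀ {i j} → lookup xs i ≡ lookup xs j → i ≡ j
  unique⇒lookup-injective (x∉ ∷ u) {zero} {zero} _ = refl
  unique⇒lookup-injective (x∉ ∷ u) {zero} {suc j} e = ⊥-elim (All.lookup x∉ (∈-lookup j) e)
  unique⇒lookup-injective (x∉ ∷ u) {suc i} {zero} e = ⊥-elim (All.lookup x∉ (∈-lookup i) (sym e))
  unique⇒lookup-injective (x∉ ∷ u) {suc i} {suc j} e = cong suc (unique⇒lookup-injective u e)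

module _ {n : ℕ} where
  open ListMembership (_≟_ {n}) using () renaming (_∈_ to _∈ₗ_; _∈?_ to _∈ₗ?_)

  Path : (Fin n → Fin n → Set) → Fin n → Fin n → Set
  Path R x y = Σ (List (Fin n)) λ ms → Unique (walkSeq x ms y) × AllSteps R (walkSeq x ms y)

  walkSeq-distinct : ∀ {x y : Fin n} ms → Unique (walkSeq x ms y) → x ≢ y
  walkSeq-distinct ms (x∉ ∷ _) = All.head (++⁻ʳ ms x∉)

  unique⇒length≤ : ∀ {xs : List (Fin n)} → Unique xs → length xs ≤ n
  unique⇒length≤ u = injective⇒≤ (unique⇒lookup-injective u)

  allSteps⇒star : ∀ {R : Fin n → Fin n → Set} x ms y → AllSteps R (walkSeq x ms y) → Star R x y
  allSteps⇒star x [] y (r ∷ []) = r ◅ ε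
  allSteps⇒star x (z ∷ ms) y (r ∷ rs) = r ◅ allSteps⇒star z ms y rs

  Terminal : (Fin n → Fin n → Set) → Fin n → Set
  Terminal R x = ∀ y → Star R x y → Star R y x

  module Reachability {R : Fin n → Fin n → Set} (R? : ∀ x y → Dec (R x y)) where

    path-suffix : ∀ {x} z ms y → x ∈ₗ walkSeq z ms y → x ≢ y →
                  Unique (walkSeq z ms y) → AllSteps R (walkSeq z ms y) → Path R x y
    path-suffix z ms y (here refl) _ u rs = ms , u , rs
    path-suffix z [] y (there (here refl)) x≢y = ⊥-elim (x≢y refl)
    path-suffix z (m ∷ ms) y (there x∈) x≢y (_ ∷ u) (_ ∷ rs) = path-suffix m ms y x∈ x≢y u rs

    star⇒path : ∀ {x y} → Star R x y → x ≡ y ⊎ Path R x y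
    star⇒path ε = inj₁ refl
    star⇒path {x} {y} (_◅_ {j = z} r w) with x ≟ y | star⇒path w
    ... | yes x≡y | _ = inj₁ x≡y
    ... | no x≢y | inj₁ refl = inj₂ ([] , (x≢y ∷ []) ∷ [] ∷ [] , r ∷ [])
    ... | no x≢y | inj₂ (ms , u , rs) with x ∈ₗ? walkSeq z ms y
    ...   | yes x∈ = inj₂ (path-suffix z ms y x∈ x≢y u rs)
    ...   | no x∉ = inj₂ (z ∷ ms , ¬Any⇒All¬ _ x∉ ∷ u , r ∷ rs)

    Within : ℕ → Fin n → Fin n → Set
    Within ℕ.zero x y = x ≡ y
    Within (ℕ.suc k) x y = x ≡ y ⊎ ∃ λ z → R x z × Within k z y

    within? : ∀ k x y → Dec (Within k x y)
    within? ℕ.zero x y = x ≟ y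
    within? (ℕ.suc k) x y = (x ≟ y) ⊎-dec any? (λ z → R? x z ×-dec within? k z y)

    within-refl : ∀ k {x} → Within k x x
    within-refl ℕ.zero = refl
    within-refl (ℕ.suc k) = inj₁ refl

    within⇒star : ∀ k {x y} → Within k x y → Star R x y
    within⇒star ℕ.zero refl = ε
    within⇒star (ℕ.suc k) (inj₁ refl) = ε
    within⇒star (ℕ.suc k) (inj₂ (z , r , w)) = r ◅ within⇒star k w

    allSteps⇒within : ∀ k x ms y → AllSteps R (walkSeq x ms y) → length (ms ++ [ y ]) ≤ k
                    → Within k x y
    allSteps⇒within (ℕ.suc k) x [] y (r ∷ []) _ = inj₂ (y , r , within-refl k)
    allSteps⇒within (ℕ.suc k) x (z ∷ ms) y (r ∷ rs) (s≤s l) =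
      inj₂ (z , r , allSteps⇒within k z ms y rs l)

    -- A shortest walk is a path, so walks of at most n arcs suffice.
    star? : ∀ x y → Dec (Star R x y)
    star? x y with within? n x y
    ... | yes w = yes (within⇒star n w)
    ... | no ¬w = no (¬w ∘ short)
      where
      short : Star R x y → Within n x y
      short w with star⇒path w
      ... | inj₁ refl = within-refl n
      ... | inj₂ (ms , u , rs) = allSteps⇒within n x ms y rs (<⇒≤ (unique⇒length≤ u))

    reachable : Fin n → Subset n
    reachable x = tabulate (λ y → does (star? x y))

    ∈-reachable⁺ : ∀ {x y} → Star R x y → y ∈ reachable x
    ∈-reachable⁺ {x} {y} w =
      lookup⇒[]= y (reachable x) (trans (lookup∘tabulate _ y) (dec-true (star? x y) w))

    ∈-reachable⁻ : ∀ {x y} → y ∈ reachable x → Star R x y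
    ∈-reachable⁻ {x} {y} y∈ with star? x y | trans (sym (lookup∘tabulate _ y)) ([]=⇒lookup y∈)
    ... | yes w | _ = w
    ... | no _ | ()

    Beyond : Fin n → Fin n → Set
    Beyond y x = Star R x y × ¬ Star R y x

    beyond⇒reachable-⊂ : ∀ {x y} → Beyond y x → reachable y ⊂ reachable x
    beyond⇒reachable-⊂ {x} {y} (x⇝y , y↛x) =
      (λ z∈ → ∈-reachable⁺ (x⇝y ◅◅ ∈-reachable⁻ z∈)) , x , ∈-reachable⁺ ε , y↛x ∘ ∈-reachable⁻

    beyond-wellFounded : WellFounded Beyond
    beyond-wellFounded =
      Subrelation.wellFounded beyond⇒reachable-⊂ (On.wellFounded reachable ⊂-wellFounded)

    terminal-exists : Fin n → ∃ (Terminal R)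
    terminal-exists = WF.All.wfRec beyond-wellFounded _ (λ _ → ∃ (Terminal R)) step
      where
      step : ∀ x → WfRec Beyond (λ _ → ∃ (Terminal R)) x → ∃ (Terminal R)
      step x IH with any? (λ y → star? x y ×-dec ¬? (star? y x))
      ... | yes (y , beyond) = IH beyond
      ... | no none = x , λ y x⇝y → decidable-stable (star? y x) (λ y↛x → none (y , x⇝y , y↛x))

module HPaths {h n : ℕ} (H : Digraph h) (c : Coloring n h) where

  hPath⇒star : ∀ {Q x y} → HPathIn H c Q x y → Star Q x y
  hPath⇒star {x = x} {y} (ms , _ , qs , _) = allSteps⇒star x ms y qs

  hPath-distinct : ∀ {Q x y} → HPathIn H c Q x y → x ≢ y
  hPath-distinct (ms , u , _) = walkSeq-distinct ms u

  hPath-mono : ∀ {Q Q' : Fin n → Fin n → Set} → (∀ {x y} → Q x y → Q' x y) →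
               ∀ {x y} → HPathIn H c Q x y → HPathIn H c Q' x y
  hPath-mono Q⇒Q' (ms , u , qs , hw) = ms , u , All.map Q⇒Q' qs , hw

  arc⇒hPath : ∀ {Q : Fin n → Fin n → Set} {x y} → x ≢ y → Q x y → HPathIn H c Q x y
  arc⇒hPath x≢y q = [] , (x≢y ∷ []) ∷ [] ∷ [] , q ∷ [] , []

  path⇒hPath : ∀ {Q} → TransitiveByHPaths H c Q → ∀ {x y} → Path Q x y → HPathIn H c Q x y
  path⇒hPath tr ([] , u , q ∷ []) = arc⇒hPath (walkSeq-distinct [] u) q
  path⇒hPath tr {x} {y} (z ∷ ms , u@(x∉ ∷ u') , q ∷ qs) =
    tr x z y (walkSeq-distinct (z ∷ ms) u) (arc⇒hPath (All.head x∉) q) (path⇒hPath tr (ms , u' , qs))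

module Semikernels {h n : ℕ} (H : Digraph h) (D : Digraph n) (c : Coloring n h) where
  open HPaths H c

  Reversible : (Fin n → Fin n → Set) → Set
  Reversible Q = ∀ {x y} → HPathIn H c Q x y → Star Q y x → HPathIn H c (Arc D) y x

  Independent : Subset n → Set
  Independent S = ∀ x y → x ∈ S → y ∈ S → x ≢ y → ¬ HPathIn H c (Arc D) x y

  terminal-semikernel : ∀ {P₁} w → Reversible P₁ → Terminal P₁ w → IsHSemikernelMod H D c P₁ ⁅ w ⁆
  terminal-semikernel {P₁} w rev terminal = independent , absorbing
    where
    independent : Independent ⁅ w ⁆
    independent x y x∈ y∈ x≢y _ = x≢y (trans (x∈⁅y⁆⇒x≡y w x∈) (sym (x∈⁅y⁆⇒x≡y w y∈)))

    absorbing : ∀ z → z ∉ ⁅ w ⁆ → (∃ λ s → s ∈ ⁅ w ⁆ × HPathIn H c P₁ s z)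
              → ∃ λ s → s ∈ ⁅ w ⁆ × HPathIn H c (Arc D) z s
    absorbing z _ (s , s∈ , p) with x∈⁅y⁆⇒x≡y w s∈
    ... | refl = w , x∈⁅x⁆ w , rev p (terminal z (hPath⇒star p))

  module _ {P₂ : Fin n → Fin n → Set} (P₂? : ∀ x y → Dec (P₂ x y))
           (P₂⊆D : ∀ {x y} → P₂ x y → Arc D x y) (rev : Reversible P₂) where
    open Reachability P₂? using (Beyond; beyond-wellFounded)

    OneWay : Fin n → Fin n → Set
    OneWay e f = HPathIn H c P₂ e f × ¬ HPathIn H c (Arc D) f e

    oneWay⇒beyond : ∀ {e f} → OneWay e f → Beyond f e
    oneWay⇒beyond (p , noReturn) = hPath⇒star p , noReturn ∘ rev p

    _⟶_ : Subset n → Subset n → Set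
    S ⟶ T = Independent S × DSArc H D c P₂ S T

    NoOneWayOnto : Fin n → Set
    NoOneWayOnto f = ∀ {S T e} → S ⟶ T → Star _⟶_ T S → e ∈ S → f ∈ T → ¬ OneWay e f

    no-oneWay : ∀ f → NoOneWayOnto f
    no-oneWay = WF.All.wfRec beyond-wellFounded _ NoOneWayOnto step
      where
      -- Along the closed walk f is never moved forward (induction), so it returns
      -- to S, where it contradicts independence with e.
      step : ∀ f → WfRec Beyond NoOneWayOnto f → NoOneWayOnto f
      step f IH {S} S⟶T@(independent , _) back e∈ f∈ (p , _) =
        independent _ f e∈ (returns (S⟶T ◅ ε) back f∈) (hPath-distinct p) (hPath-mono P₂⊆D p)
        where
        returns : ∀ {U} → Star _⟶_ S U → Star _⟶_ U S → f ∈ U → f ∈ S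
        returns pre ε f∈U = f∈U
        returns pre (U⟶V ◅ post) f∈U with proj₂ (proj₂ U⟶V) f f∈U
        ... | _ , f∈V , inj₁ refl = returns (pre ◅◅ U⟶V ◅ ε) post f∈V
        ... | _ , f'∈V , inj₂ oneWay =
          ⊥-elim (IH (oneWay⇒beyond oneWay) U⟶V (post ◅◅ pre) f∈U f'∈V oneWay)

    ⟶-⊆ : ∀ {S T} → S ⟶ T → Star _⟶_ T S → S ⊆ T
    ⟶-⊆ S⟶T back {x} x∈ with proj₂ (proj₂ S⟶T) x x∈
    ... | _ , x∈T , inj₁ refl = x∈T
    ... | x' , x'∈T , inj₂ oneWay = ⊥-elim (no-oneWay x' S⟶T back x∈ x'∈T oneWay)

    closedWalk-⊆ : ∀ {S T} → Star _⟶_ S T → Star _⟶_ T S → T ⊆ S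
    closedWalk-⊆ pre ε = λ x∈ → x∈
    closedWalk-⊆ pre (T⟶U ◅ post) =
      λ x∈ → closedWalk-⊆ (pre ◅◅ T⟶U ◅ ε) post (⟶-⊆ T⟶U (post ◅◅ pre) x∈)

    no-closedWalk : ∀ {S T} → S ⟶ T → ¬ Star _⟶_ T S
    no-closedWalk S⟶T back =
      proj₁ (proj₂ S⟶T) (⊆-antisym (⟶-⊆ S⟶T back) (closedWalk-⊆ (S⟶T ◅ ε) back))

    cycle⇒closedWalk : ∀ S Ss U → All Independent (S ∷ Ss)
                     → AllSteps (DSArc H D c P₂) (S ∷ Ss ++ [ U ])
                     → ∃ λ T → S ⟶ T × Star _⟶_ T U
    cycle⇒closedWalk S [] U (i ∷ []) (a ∷ []) = U , (i , a) , ε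
    cycle⇒closedWalk S (T ∷ Ss) U (i ∷ is) (a ∷ as) =
      let _ , T⟶ , walk = cycle⇒closedWalk T Ss U is as in T , (i , a) , T⟶ ◅ walk

    independent-acyclic : ¬ HasCycle Independent (DSArc H D c P₂)
    independent-acyclic (S , Ss , independent , _ , arcs) =
      let _ , S⟶T , back = cycle⇒closedWalk S Ss S independent arcs in no-closedWalk S⟶T back

module ClassPartition {h n k : ℕ} (H : Digraph h) (D : Digraph n) (c : Coloring n h)
  (loopless : ∀ v → ¬ Arc D v v)
  (cls : Fin h → Fin k)
  (transitive : ∀ m → TransitiveByHPaths H c (λ u v → Arc D u v × cls (c u v) ≡ m))
  (side : Fin k → Fin 2)
  (cycles : ∀ (i : Fin 2) x ms → CycleIn (λ u v → Arc D u v × side (cls (c u v)) ≡ i) x ms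
            → ∃ λ m → side m ≡ i × CycleIn (λ u v → Arc D u v × cls (c u v) ≡ m) x ms)
  (walks : ∀ (i : Fin 2) x ms y → HWalkIn H c (λ u v → Arc D u v × side (cls (c u v)) ≡ i) x ms y
           → ∃ λ m → side m ≡ i × HWalkIn H c (λ u v → Arc D u v × cls (c u v) ≡ m) x ms y)
  where
  open HPaths H c
  open Semikernels H D c using (Reversible)

  Class : Fin k → Fin n → Fin n → Set
  Class m u v = Arc D u v × cls (c u v) ≡ m

  Side : Fin 2 → Fin n → Fin n → Set
  Side i u v = Arc D u v × side (cls (c u v)) ≡ i

  side? : ∀ i x y → Dec (Side i x y)
  side? i x y = T? (D x y) ×-dec (side (cls (c x y)) ≟ i)

  class⇒side : ∀ {i m u v} → side m ≡ i → Class m u v → Side i u v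
  class⇒side s (a , e) = a , trans (cong side e) s

  class-unique : ∀ {m m' u v} → Class m u v → Class m' u v → m ≡ m'
  class-unique (_ , e) (_ , e') = trans (sym e) e'

  classArc-reversible : ∀ {i m u v} → side m ≡ i → Class m u v → Star (Side i) v u
                      → HPathIn H c (Class m) v u
  classArc-reversible {i} {u = u} {v} s g back with Reachability.star⇒path (side? i) back
  ... | inj₁ refl = ⊥-elim (loopless u (proj₁ g))
  ... | inj₂ (ms , uniq , steps)
    with cycles i u (v ∷ ms) (unique-rotate (v ∷ ms) uniq , class⇒side s g ∷ steps)
  ... | _ , _ , _ , g' ∷ steps' with class-unique g g'
  ... | refl = path⇒hPath (transitive _) (ms , uniq , steps')

  classPath-reversible : ∀ {i m x y} → side m ≡ i → Path (Class m) x y → Star (Side i) y x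
                       → HPathIn H c (Class m) y x
  classPath-reversible s ([] , _ , g ∷ []) back = classArc-reversible s g back
  classPath-reversible {x = x} {y} s (z ∷ ms , uniq@(_ ∷ uniq') , g ∷ gs) back =
    transitive _ y z x (walkSeq-distinct (z ∷ ms) uniq ∘ sym)
      (classPath-reversible s (ms , uniq' , gs) (back ◅◅ class⇒side s g ◅ ε))
      (classArc-reversible s g (Star.map (class⇒side s) (allSteps⇒star z ms y gs) ◅◅ back))

  side-reversible : ∀ i → Reversible (Side i)
  side-reversible i {x} {y} (ms , uniq , walk) back with walks i x ms y walk
  ... | _ , s , steps , _ = hPath-mono proj₁ (classPath-reversible s (ms , uniq , steps) back)

mainTheorem8 : ∀ {h n k : ℕ} (H : Digraph h) (D : Digraph n) (c : Coloring n h)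
    → (∀ v → ¬ Arc D v v)
    → (∀ v → ∃ λ w → Arc D v w ⊎ Arc D w v)
    → 2 ≤ k
    → (cls : Fin h → Fin k)
    → (∀ i → ∃ λ u → ∃ λ v → Arc D u v × cls (c u v) ≡ i)
    → (∀ i → TransitiveByHPaths H c (λ u v → Arc D u v × cls (c u v) ≡ i))
    → (side : Fin k → Fin 2)
    → (∃ λ j → side j ≡ zero)
    → (∃ λ j → side j ≡ suc zero)
    → (∀ (i : Fin 2) x ms → CycleIn (λ u v → Arc D u v × side (cls (c u v)) ≡ i) x ms
         → ∃ λ m → side m ≡ i × CycleIn (λ u v → Arc D u v × cls (c u v) ≡ m) x ms)
    → (∀ (i : Fin 2) x ms y → HWalkIn H c (λ u v → Arc D u v × side (cls (c u v)) ≡ i) x ms y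
         → ∃ λ m → side m ≡ i × HWalkIn H c (λ u v → Arc D u v × cls (c u v) ≡ m) x ms y)
    → (∃ λ (S : Subset n) → Nonempty S
         × IsHSemikernelMod H D c (λ u v → Arc D u v × side (cls (c u v)) ≡ zero) S)
      × ¬ HasCycle
            (λ S → Nonempty S
               × IsHSemikernelMod H D c (λ u v → Arc D u v × side (cls (c u v)) ≡ zero) S)
            (DSArc H D c (λ u v → Arc D u v × side (cls (c u v)) ≡ suc zero))
mainTheorem8 H D c loopless _ _ cls nonemptyClass transitive side (j , _) _ cycles walks =
  let w , terminal = Reachability.terminal-exists (side? zero) (proj₁ (nonemptyClass j)) in
  (⁅ w ⁆ , (w , x∈⁅x⁆ w) , terminal-semikernel w (side-reversible zero) terminal) ,
  λ (S , Ss , semikernels , distinct , arcs) →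
    independent-acyclic (side? (suc zero)) proj₁ (side-reversible (suc zero))
      (S , Ss , All.map (proj₁ ∘ proj₂) semikernels , distinct , arcs)
  where
  open ClassPartition H D c loopless cls transitive side cycles walks
  open Semikernels H D c
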